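{- For any arch systems $A$ and $B$, with atoms $a=\langle A\rangle$ and $b=\langle B\rangle$, the classes $\mathrm{Av}(A)$ and $\mathrm{Av}(B)$ are Wilf-equivalent if and only if $\mathrm{Av}(a)$ and $\mathrm{Av}(b)$ are Wilf-equivalent.
   Context: An arch system of size $n$ is a set of $n$ arches drawn above a horizontal baseline, connecting $2n$ points on the baseline so that every point is an endpoint of exactly one arch and no two arches cross (only the combinatorial configuration matters); the empty arch system has size $0$. $B$ is contained in $A$ if $B$ can be obtained from $A$ by deleting some arches; $\mathrm{Av}(A)$ is the set of arch systems not containing $A$. For an arch system $A$, $\langle A\rangle$ denotes the arch system obtained by adding one arch enclosing all of $A$ (an atom with contents $A$). Two classes are Wilf-equivalent if they contain the same number of arch systems of each size. -}

module Defs where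

open import Data.Nat using (ℕ; zero; suc; _+_)
open import Data.List using (List; []; _∷_; _++_)
open import Data.Refinement using (Refinement)
open import Relation.Binary.PropositionalEquality using (_≡_)
open import Relation.Binary.Construct.Closure.ReflexiveTransitive using (Star)
open import Relation.Nullary using (¬_)
open import Function.Bundles using (_↔_)

-- An arch system is encoded as a plane forest: the list (left to right) of
-- its outermost arches, each arch carrying the arch system nested directly
-- beneath it.  This is a bijective encoding of non-crossing perfect
-- matchings of 2n baseline points up to combinatorial equivalence.
data Arch : Set where
  arch : List Arch → Arch

ArchSystem : Set
ArchSystem = List Arch

mutual
  size : ArchSystem → ℕ
  size [] = zero
  size (t ∷ ts) = sizeArch t + size ts

  sizeArch : Arch → ℕ
  sizeArch (arch cs) = suc (size cs)

data Del1 : ArchSystem → ArchSystem → Set where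
  here   : ∀ {cs ts} → Del1 (arch cs ∷ ts) (cs ++ ts)
  inside : ∀ {cs cs′ ts} → Del1 cs cs′ → Del1 (arch cs ∷ ts) (arch cs′ ∷ ts)
  later  : ∀ {t ts ts′} → Del1 ts ts′ → Del1 (t ∷ ts) (t ∷ ts′)

_contains_ : ArchSystem → ArchSystem → Set
A contains B = Star Del1 A B

-- Arch systems of size n in Av(A)  (the proof part is irrelevant, so
-- elements are identified by their underlying arch system).
Av : ArchSystem → ℕ → Set
Av A n = Refinement ArchSystem (λ X → size X ≡ n × ¬ (X contains A))
  where open import Data.Product using (_×_)

-- Wilf-equivalence: for every size n, the two classes have the same number
-- of arch systems of size n, i.e. their size-n parts are in bijection.
WilfEquivalent : ArchSystem → ArchSystem → Set
WilfEquivalent A B = ∀ (n : ℕ) → Av A n ↔ Av B n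

⟨_⟩ : ArchSystem → ArchSystem
⟨ A ⟩ = arch A ∷ []

-- Every nonempty arch system is uniquely arch c ∷ r, and it avoids ⟨ A ⟩
-- exactly when c avoids A and r avoids ⟨ A ⟩.  So if f n and g n count the
-- systems of size n avoiding A and ⟨ A ⟩, then g 0 = 1 and
-- g (n + 1) = ∑_{j ≤ n} f (n - j) · g j.  By strong induction f determines g,
-- and conversely g determines f: the j = 0 term of g (n + 1) is f n · g 0 = f n,
-- and the other terms only involve f below n.  The size classes being finite,
-- Wilf-equivalence is just equality of these counting sequences.
module Submission where

open import Defs
open import Axiom.UniquenessOfIdentityProofs using (module Decidable⇒UIP)
open import Data.Nat.Properties using (+-0-monoid)
open import Algebra.Properties.Monoid.Sum +-0-monoid using (sum; sum-cong-≗; sum-syntax; sum⁺-syntax)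
open import Data.Empty using (⊥-elim-irr)
open import Data.Fin using (Fin; zero; suc; toℕ; fromℕ<)
open import Data.Fin.Permutation using (↔⇒≡)
open import Data.Fin.Properties using (toℕ<n; toℕ≤pred[n]; toℕ-fromℕ<; fromℕ<-toℕ; fromℕ<-cong; +↔⊎; *↔×; 1↔⊤)
open import Data.Irrelevant using ([_])
open import Data.List using (List; []; _∷_; _++_; map; filter; deduplicate; length; lookup; cartesianProductWith)
open import Data.List.Membership.Propositional using (_∈_; find; lose)
open import Data.List.Membership.Propositional.Properties
  using (∈-++⁺ˡ; ∈-++⁺ʳ; ∈-map⁺; ∈-cartesianProductWith⁺; ∈-filter⁺; ∈-filter⁻; ∈-deduplicate⁺; ∈-deduplicate⁻; ∈-lookup)
open import Data.List.Membership.Setoid.Properties using (unique⇒irrelevant)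
open import Data.List.Properties using (++-identityʳ)
open import Data.List.Relation.Unary.Any using (Any; here; there; index; any?)
open import Data.List.Relation.Unary.Any.Properties using (lookup-index; ++⁻)
open import Data.List.Relation.Unary.Unique.DecPropositional.Properties using (deduplicate-!)
open import Data.Nat using (ℕ; zero; suc; _+_; _*_; _∸_; _≤_; _<_; s≤s; s≤s⁻¹)
open import Data.Nat.Induction using (<-rec)
open import Data.Nat.Properties using (_≟_; 0≢1+n; suc-injective; ≤-refl; ≤-trans; +-assoc; +-suc; m≤m+n; m≤n+m; m+n∸n≡m; m∸n+n≡m; m∸n≤m; +-cancelʳ-≡; *-identityʳ)
open import Data.Product using (_×_; _,_; ∃; proj₁; proj₂; Σ)
import Data.Product as Product
open import Data.Product.Function.NonDependent.Propositional using (_×-↔_)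
open import Data.Refinement using (Refinement; _,_; value; value-injective)
open import Data.Sum using (_⊎_; inj₁; inj₂)
open import Data.Sum.Function.Propositional using (_⊎-↔_)
open import Data.Unit using (⊤)
open import Function using (_∘_)
open import Function.Bundles using (_↔_; mk↔ₛ′)
open import Function.Properties.Inverse using (↔-sym; ↔-trans)
open import Relation.Binary.Construct.Closure.ReflexiveTransitive using (ε; _◅_; _◅◅_; gmap)
open import Relation.Binary.Definitions using (DecidableEquality)
open import Relation.Binary.PropositionalEquality using (_≡_; refl; sym; trans; cong; cong₂; subst; _≗_; setoid; module ≡-Reasoning)
open import Relation.Nullary using (¬_; Dec; yes; no; recompute)
open import Relation.Nullary.Decidable using (_×-dec_; ¬?)
open import Relation.Unary using (Decidable)

mutual
  _≟ᵃ_ : DecidableEquality Arch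
  arch cs ≟ᵃ arch ds with cs ≟ˢ ds
  ... | yes refl = yes refl
  ... | no cs≢ds = no λ { refl → cs≢ds refl }

  _≟ˢ_ : DecidableEquality ArchSystem
  [] ≟ˢ [] = yes refl
  [] ≟ˢ (_ ∷ _) = no λ ()
  (_ ∷ _) ≟ˢ [] = no λ ()
  (t ∷ ts) ≟ˢ (u ∷ us) with t ≟ᵃ u | ts ≟ˢ us
  ... | yes refl | yes refl = yes refl
  ... | no t≢u | _ = no λ { refl → t≢u refl }
  ... | _ | no ts≢us = no λ { refl → ts≢us refl }

size-++ : ∀ xs ys → size (xs ++ ys) ≡ size xs + size ys
size-++ [] ys = refl
size-++ (x ∷ xs) ys = trans (cong (sizeArch x +_) (size-++ xs ys)) (sym (+-assoc (sizeArch x) (size xs) (size ys)))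

size-Del1 : ∀ {X Y} → Del1 X Y → size X ≡ suc (size Y)
size-Del1 (here {cs} {ts}) = cong suc (sym (size-++ cs ts))
size-Del1 (inside d) = cong (λ k → suc (k + _)) (size-Del1 d)
size-Del1 {t ∷ _} (later d) = trans (cong (sizeArch t +_) (size-Del1 d)) (+-suc (sizeArch t) _)

deletions : (X : ArchSystem) → List (∃ (Del1 X))
deletions [] = []
deletions (arch cs ∷ ts) =
  (cs ++ ts , here)
    ∷ map (Product.map (λ cs′ → arch cs′ ∷ ts) inside) (deletions cs)
   ++ map (Product.map (arch cs ∷_) later) (deletions ts)

∈-deletions : ∀ {X Y} (d : Del1 X Y) → (Y , d) ∈ deletions X
∈-deletions here = here refl
∈-deletions {arch cs ∷ ts} (inside d) =
  there (∈-++⁺ˡ (∈-map⁺ (Product.map (λ cs′ → arch cs′ ∷ ts) inside) (∈-deletions d)))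
∈-deletions {arch cs ∷ ts} (later d) =
  there (∈-++⁺ʳ _ (∈-map⁺ (Product.map (arch cs ∷_) later) (∈-deletions d)))

contains? : ∀ B n X → size X < n → Dec (X contains B)
contains? B (suc n) X X<1+n with X ≟ˢ B
... | yes refl = yes ε
... | no X≢B with any? (λ (Y , d) → contains? B n Y (Y<n d)) (deletions X)
  where
  Y<n : ∀ {Y} → Del1 X Y → size Y < n
  Y<n d = subst (_≤ n) (size-Del1 d) (s≤s⁻¹ X<1+n)
...   | yes found = yes (let (_ , d) , _ , Y⊇B = find found in d ◅ Y⊇B)
...   | no none = no λ { ε → X≢B refl ; (d ◅ Y⊇B) → none (lose (∈-deletions d) Y⊇B) }

systemsOfSizeAtMost : ℕ → List ArchSystem
systemsOfSizeAtMost zero = [] ∷ []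
systemsOfSizeAtMost (suc n) =
  [] ∷ cartesianProductWith (λ cs ts → arch cs ∷ ts) (systemsOfSizeAtMost n) (systemsOfSizeAtMost n)

∈-systemsOfSizeAtMost : ∀ n X → size X ≤ n → X ∈ systemsOfSizeAtMost n
∈-systemsOfSizeAtMost zero [] _ = here refl
∈-systemsOfSizeAtMost zero (arch _ ∷ _) ()
∈-systemsOfSizeAtMost (suc n) [] _ = here refl
∈-systemsOfSizeAtMost (suc n) (arch cs ∷ ts) (s≤s X≤n) =
  there (∈-cartesianProductWith⁺ (λ cs ts → arch cs ∷ ts)
          (∈-systemsOfSizeAtMost n cs (≤-trans (m≤m+n (size cs) (size ts)) X≤n))
          (∈-systemsOfSizeAtMost n ts (≤-trans (m≤n+m (size ts) (size cs)) X≤n)))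

module _ {X : Set} (_≟ₓ_ : DecidableEquality X) {P : X → Set} (P? : Decidable P)
         (xs : List X) (covers : ∀ {x} → P x → x ∈ xs) where

  private
    ys : List X
    ys = deduplicate _≟ₓ_ (filter P? xs)

    ∈ys : ∀ {x} → P x → x ∈ ys
    ∈ys px = ∈-deduplicate⁺ _≟ₓ_ (∈-filter⁺ P? (covers px) px)

    ∈ys⇒P : ∀ {x} → x ∈ ys → P x
    ∈ys⇒P x∈ys = proj₂ (∈-filter⁻ P? {xs = xs} (∈-deduplicate⁻ _≟ₓ_ (filter P? xs) x∈ys))

    index-∈-lookup : ∀ (zs : List X) i → index (∈-lookup {xs = zs} i) ≡ i
    index-∈-lookup (_ ∷ _) zero = refl
    index-∈-lookup (_ ∷ zs) (suc i) = cong suc (index-∈-lookup zs i)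

    ∈ys-irrelevant : ∀ {x} (p q : x ∈ ys) → p ≡ q
    ∈ys-irrelevant = unique⇒irrelevant (setoid X) (Decidable⇒UIP.≡-irrelevant _≟ₓ_) (deduplicate-! _≟ₓ_ (filter P? xs))

  refinement↔Fin : ∃ λ m → Refinement X P ↔ Fin m
  refinement↔Fin = length ys , mk↔ₛ′ to from to∘from from∘to
    where
    to : Refinement X P → Fin (length ys)
    to (x , [ px ]) = index (∈ys (recompute (P? x) px))
    from : Fin (length ys) → Refinement X P
    from i = lookup ys i , [ ∈ys⇒P (∈-lookup i) ]
    to∘from : ∀ i → to (from i) ≡ i
    to∘from i = trans (cong index (∈ys-irrelevant _ (∈-lookup i))) (index-∈-lookup ys i)
    from∘to : ∀ x → from (to x) ≡ x
    from∘to (x , [ px ]) = value-injective (sym (lookup-index (∈ys (recompute (P? x) px))))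

finite-Av : ∀ A n → ∃ λ m → Av A n ↔ Fin m
finite-Av A n =
  refinement↔Fin _≟ˢ_ (λ X → (size X ≟ n) ×-dec ¬? (contains? A (suc (size X)) X (s≤s ≤-refl)))
    (systemsOfSizeAtMost n) (λ { (refl , _) → ∈-systemsOfSizeAtMost _ _ ≤-refl })

count : ArchSystem → ℕ → ℕ
count A n = proj₁ (finite-Av A n)

Av↔Fin-count : ∀ A n → Av A n ↔ Fin (count A n)
Av↔Fin-count A n = proj₂ (finite-Av A n)

wilf⇒count-≗ : ∀ {A B} → WilfEquivalent A B → count A ≗ count B
wilf⇒count-≗ {A} {B} A~B n = ↔⇒≡ (↔-trans (↔-sym (Av↔Fin-count A n)) (↔-trans (A~B n) (Av↔Fin-count B n)))

count-≗⇒wilf : ∀ {A B} → count A ≗ count B → WilfEquivalent A B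
count-≗⇒wilf {A} {B} A≗B n =
  ↔-trans (subst (λ k → Av A n ↔ Fin k) (A≗B n) (Av↔Fin-count A n)) (↔-sym (Av↔Fin-count B n))

contains-[] : ∀ X → X contains []
contains-[] [] = ε
contains-[] (arch cs ∷ ts) = gmap (λ cs′ → arch cs′ ∷ ts) inside (contains-[] cs) ◅◅ here ◅ contains-[] ts

contains-tail : ∀ t ts → (t ∷ ts) contains ts
contains-tail (arch cs) ts = gmap (λ cs′ → arch cs′ ∷ ts) inside (contains-[] cs) ◅◅ here ◅ ε

atom-contains : ∀ A → ⟨ A ⟩ contains A
atom-contains A = subst (⟨ A ⟩ contains_) (++-identityʳ A) (here ◅ ε)

Encloses : ArchSystem → Arch → Set
Encloses A (arch cs) = cs contains A

encloses⇒contains-atom : ∀ {A X} → Any (Encloses A) X → X contains ⟨ A ⟩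
encloses⇒contains-atom (here {arch cs} {ts} cs⊇A) =
  gmap (arch cs ∷_) later (contains-[] ts) ◅◅ gmap (λ cs′ → arch cs′ ∷ []) inside cs⊇A
encloses⇒contains-atom (there {t} {ts} h) = contains-tail t ts ◅◅ encloses⇒contains-atom h

Del1-reflects-encloses : ∀ {A X Y} → Del1 X Y → Any (Encloses A) Y → Any (Encloses A) X
Del1-reflects-encloses {A} (here {cs}) h with ++⁻ cs h
... | inj₁ h-cs = here (encloses⇒contains-atom h-cs ◅◅ atom-contains A)
... | inj₂ h-ts = there h-ts
Del1-reflects-encloses (inside d) (here cs′⊇A) = here (d ◅ cs′⊇A)
Del1-reflects-encloses (inside d) (there h) = there h
Del1-reflects-encloses (later d) (here p) = here p
Del1-reflects-encloses (later d) (there h) = there (Del1-reflects-encloses d h)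

contains-atom⇒encloses : ∀ {A X} → X contains ⟨ A ⟩ → Any (Encloses A) X
contains-atom⇒encloses ε = here ε
contains-atom⇒encloses (d ◅ Y⊇⟨A⟩) = Del1-reflects-encloses d (contains-atom⇒encloses Y⊇⟨A⟩)

avoids-atom⁻ : ∀ {A cs ts} → ¬ ((arch cs ∷ ts) contains ⟨ A ⟩) → ¬ (cs contains A) × ¬ (ts contains ⟨ A ⟩)
avoids-atom⁻ avoid =
  (λ cs⊇A → avoid (encloses⇒contains-atom (here cs⊇A))) ,
  (λ ts⊇⟨A⟩ → avoid (encloses⇒contains-atom (there (contains-atom⇒encloses ts⊇⟨A⟩))))

avoids-atom⁺ : ∀ {A cs ts} → ¬ (cs contains A) → ¬ (ts contains ⟨ A ⟩) → ¬ ((arch cs ∷ ts) contains ⟨ A ⟩)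
avoids-atom⁺ cs⊉A ts⊉⟨A⟩ X⊇⟨A⟩ with contains-atom⇒encloses X⊇⟨A⟩
... | here cs⊇A = cs⊉A cs⊇A
... | there h = ts⊉⟨A⟩ (encloses⇒contains-atom h)

module _ (A : ArchSystem) (n : ℕ) where

  private
    Split : Set
    Split = Σ (Fin (suc n)) λ j → Av A (n ∸ toℕ j) × Av ⟨ A ⟩ (toℕ j)

    tail<1+n : ∀ cs ts → suc (size cs + size ts) ≡ suc n → size ts < suc n
    tail<1+n cs ts e = s≤s (subst (size ts ≤_) (suc-injective e) (m≤n+m (size ts) (size cs)))

    contents-size : ∀ cs ts → suc (size cs + size ts) ≡ suc n → size cs ≡ n ∸ size ts
    contents-size cs ts e = trans (sym (m+n∸n≡m (size cs) (size ts))) (cong (_∸ size ts) (suc-injective e))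

    split-≡ : ∀ {j j′ : Fin (suc n)} {x : Av A (n ∸ toℕ j)} {x′ : Av A (n ∸ toℕ j′)}
                {y : Av ⟨ A ⟩ (toℕ j)} {y′ : Av ⟨ A ⟩ (toℕ j′)} →
              j ≡ j′ → value x ≡ value x′ → value y ≡ value y′ → _≡_ {A = Split} (j , x , y) (j′ , x′ , y′)
    split-≡ {x = _ , _} {_ , _} {_ , _} {_ , _} refl refl refl = refl

  atom-avoiders↔ : Av ⟨ A ⟩ (suc n) ↔ Split
  atom-avoiders↔ = mk↔ₛ′ to from to∘from from∘to
    where
    to : Av ⟨ A ⟩ (suc n) → Split
    to ([] , [ p ]) = ⊥-elim-irr (0≢1+n (proj₁ p))
    to (arch cs ∷ ts , [ p ]) =
      fromℕ< (tail<1+n cs ts (proj₁ p)) ,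
      (cs , [ trans (contents-size cs ts (proj₁ p)) (cong (n ∸_) (sym (toℕ-fromℕ< (tail<1+n cs ts (proj₁ p)))))
            , proj₁ (avoids-atom⁻ (proj₂ p)) ]) ,
      (ts , [ sym (toℕ-fromℕ< (tail<1+n cs ts (proj₁ p))) , proj₂ (avoids-atom⁻ (proj₂ p)) ])

    from : Split → Av ⟨ A ⟩ (suc n)
    from (j , (cs , [ pcs ]) , (ts , [ pts ])) =
      arch cs ∷ ts ,
      [ cong suc (trans (cong₂ _+_ (proj₁ pcs) (proj₁ pts)) (m∸n+n≡m (toℕ≤pred[n] j))) , avoids-atom⁺ (proj₂ pcs) (proj₂ pts) ]

    to∘from : ∀ z → to (from z) ≡ z
    to∘from (j , (cs , _) , (ts , [ pts ])) =
      split-≡ (trans (fromℕ<-cong _ _ (recompute (size ts ≟ toℕ j) (proj₁ pts)) _ (toℕ<n j)) (fromℕ<-toℕ j (toℕ<n j)))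
              refl refl

    from∘to : ∀ X → from (to X) ≡ X
    from∘to (arch cs ∷ ts , _) = refl

Σ-Fin-suc↔⊎ : ∀ {m} (P : Fin (suc m) → Set) → Σ (Fin (suc m)) P ↔ (P zero ⊎ Σ (Fin m) (P ∘ suc))
Σ-Fin-suc↔⊎ P = mk↔ₛ′ to from to∘from from∘to
  where
  to : Σ _ P → P zero ⊎ Σ _ (P ∘ suc)
  to (zero , x) = inj₁ x
  to (suc i , x) = inj₂ (i , x)
  from : P zero ⊎ Σ _ (P ∘ suc) → Σ _ P
  from (inj₁ x) = zero , x
  from (inj₂ (i , x)) = suc i , x
  to∘from : ∀ z → to (from z) ≡ z
  to∘from (inj₁ _) = refl
  to∘from (inj₂ _) = refl
  from∘to : ∀ z → from (to z) ≡ z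
  from∘to (zero , _) = refl
  from∘to (suc _ , _) = refl

Σ-Fin↔Fin-sum : ∀ {m} {P : Fin m → Set} (f : Fin m → ℕ) → (∀ i → P i ↔ Fin (f i)) → Σ (Fin m) P ↔ Fin (sum f)
Σ-Fin↔Fin-sum {zero} f _ = mk↔ₛ′ (λ { (() , _) }) (λ ()) (λ ()) (λ { (() , _) })
Σ-Fin↔Fin-sum {suc m} {P} f P↔f =
  ↔-trans (Σ-Fin-suc↔⊎ P) (↔-trans (P↔f zero ⊎-↔ Σ-Fin↔Fin-sum (f ∘ suc) (P↔f ∘ suc)) (↔-sym +↔⊎))

count-atom-zero : ∀ A → count ⟨ A ⟩ 0 ≡ 1
count-atom-zero A = ↔⇒≡ (↔-trans (↔-sym (Av↔Fin-count ⟨ A ⟩ 0)) (↔-trans Av-atom-0↔⊤ (↔-sym 1↔⊤)))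
  where
  []⊉⟨A⟩ : ¬ ([] contains ⟨ A ⟩)
  []⊉⟨A⟩ (() ◅ _)
  only-[] : ∀ (X : Av ⟨ A ⟩ 0) → ([] , [ refl , []⊉⟨A⟩ ]) ≡ X
  only-[] ([] , _) = refl
  only-[] (arch _ ∷ _ , [ p ]) = ⊥-elim-irr (0≢1+n (sym (proj₁ p)))
  Av-atom-0↔⊤ : Av ⟨ A ⟩ 0 ↔ ⊤
  Av-atom-0↔⊤ = mk↔ₛ′ _ (λ _ → [] , [ refl , []⊉⟨A⟩ ]) (λ _ → refl) only-[]

count-atom-suc : ∀ A n → count ⟨ A ⟩ (suc n) ≡ ∑[ j ≤ n ] (count A (n ∸ toℕ j) * count ⟨ A ⟩ (toℕ j))
count-atom-suc A n = ↔⇒≡ (↔-trans (↔-sym (Av↔Fin-count ⟨ A ⟩ (suc n))) (↔-trans (atom-avoiders↔ A n)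
  (Σ-Fin↔Fin-sum _ λ j → ↔-trans (Av↔Fin-count A _ ×-↔ Av↔Fin-count ⟨ A ⟩ _) (↔-sym *↔×))))

AtomRecurrence : (f g : ℕ → ℕ) → Set
AtomRecurrence f g = g 0 ≡ 1 × (∀ n → g (suc n) ≡ ∑[ j ≤ n ] (f (n ∸ toℕ j) * g (toℕ j)))

atomRecurrence : ∀ A → AtomRecurrence (count A) (count ⟨ A ⟩)
atomRecurrence A = count-atom-zero A , count-atom-suc A

m∸[1+toℕj]<m : ∀ {m} (j : Fin m) → m ∸ suc (toℕ j) < m
m∸[1+toℕj]<m {suc m} j = s≤s (m∸n≤m m (toℕ j))

module _ {f g f′ g′ : ℕ → ℕ} (rec : AtomRecurrence f g) (rec′ : AtomRecurrence f′ g′) where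

  atomRecurrence-f≗⇒g≗ : f ≗ f′ → g ≗ g′
  atomRecurrence-f≗⇒g≗ f≗f′ = <-rec (λ n → g n ≡ g′ n) step
    where
    step : ∀ n → (∀ {m} → m < n → g m ≡ g′ m) → g n ≡ g′ n
    step zero _ = trans (proj₁ rec) (sym (proj₁ rec′))
    step (suc n) ih = begin
      g (suc n)                                  ≡⟨ proj₂ rec n ⟩
      ∑[ j ≤ n ] (f (n ∸ toℕ j) * g (toℕ j))     ≡⟨ sum-cong-≗ (λ j → cong₂ _*_ (f≗f′ (n ∸ toℕ j)) (ih (toℕ<n j))) ⟩
      ∑[ j ≤ n ] (f′ (n ∸ toℕ j) * g′ (toℕ j))   ≡⟨ proj₂ rec′ n ⟨
      g′ (suc n)                                 ∎
      where open ≡-Reasoning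

  atomRecurrence-g≗⇒f≗ : g ≗ g′ → f ≗ f′
  atomRecurrence-g≗⇒f≗ g≗g′ = <-rec (λ n → f n ≡ f′ n) step
    where
    step : ∀ n → (∀ {m} → m < n → f m ≡ f′ m) → f n ≡ f′ n
    step n ih = begin
      f n            ≡⟨ *-identityʳ (f n) ⟨
      f n * 1        ≡⟨ cong (f n *_) (proj₁ rec) ⟨
      f n * g 0      ≡⟨ +-cancelʳ-≡ _ _ _ heads+tail ⟩
      f′ n * g′ 0    ≡⟨ cong (f′ n *_) (proj₁ rec′) ⟩
      f′ n * 1       ≡⟨ *-identityʳ (f′ n) ⟩
      f′ n           ∎
      where
      open ≡-Reasoning
      tails : ∑[ j < n ] (f (n ∸ suc (toℕ j)) * g (suc (toℕ j))) ≡ ∑[ j < n ] (f′ (n ∸ suc (toℕ j)) * g′ (suc (toℕ j)))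
      tails = sum-cong-≗ (λ j → cong₂ _*_ (ih (m∸[1+toℕj]<m j)) (g≗g′ _))
      -- the sum over j ≤ n unfolds definitionally to its j = 0 term plus a sum over j < n
      heads+tail : f n * g 0 + _ ≡ f′ n * g′ 0 + _
      heads+tail = trans (cong (f n * g 0 +_) (sym tails)) (trans (sym (proj₂ rec n)) (trans (g≗g′ (suc n)) (proj₂ rec′ n)))

mainTheorem2 : (A B : ArchSystem) →
    (WilfEquivalent A B → WilfEquivalent ⟨ A ⟩ ⟨ B ⟩) × (WilfEquivalent ⟨ A ⟩ ⟨ B ⟩ → WilfEquivalent A B)
mainTheorem2 A B =
  (λ A~B → count-≗⇒wilf (atomRecurrence-f≗⇒g≗ (atomRecurrence A) (atomRecurrence B) (wilf⇒count-≗ A~B))) ,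
  (λ ⟨A⟩~⟨B⟩ → count-≗⇒wilf (atomRecurrence-g≗⇒f≗ (atomRecurrence A) (atomRecurrence B) (wilf⇒count-≗ ⟨A⟩~⟨B⟩)))
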